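{- Let $\mathcal{M}=(M_i\colon i\in K)$ be a family of matroids on a common ground set $E$, let $\mathcal{F}=(\langle I_i,S_i\rangle\colon i\in K)$ be feasible with respect to $\mathcal{M}$, let $X$ be $\mathcal{M}(\mathcal{F})$-tight, and let $(R_i\colon i\in K)$ be a covering of $(M_i(\mathcal{F})\restriction X\colon i\in K)$. Put $I_i'=I_i\cup R_i$. Then $\mathcal{F}'=(\langle I_i',S_i\rangle\colon i\in K)$ is a feasible extension of $\mathcal{F}$ with respect to $\mathcal{M}$, and $I_i'$ spans $X\cap S_i$ in $M_i$ for every $i\in K$. Furthermore, if $X$ is the $\subseteq$-largest $\mathcal{M}(\mathcal{F})$-tight set, then there is no non-empty $\mathcal{M}(\mathcal{F}')$-tight set.
   Context: Matroids are possibly infinite: a matroid on $E$ is $(E,\mathcal{I})$ with $\mathcal{I}\subseteq\mathcal{P}(E)$ such that $\emptyset\in\mathcal{I}$; $\mathcal{I}$ is closed under subsets; whenever $I,B\in\mathcal{I}$ with $B$ maximal and $I$ not maximal there is $x\in B\setminus I$ with $I\cup\{x\}\in\mathcal{I}$; and for every $X\subseteq E$ every independent $I\subseteq X$ extends to a maximal element of $\mathcal{I}\cap\mathcal{P}(X)$. Circuits are minimal dependent sets; $X$ spans $e$ if $e\in X$ or some circuit $C\ni e$ has $C\setminus\{e\}\subseteq X$; $A$ spans $Y$ if it spans every element of $Y$; $A$ is spanning in a matroid on ground set $Y$ if it spans $Y$. Restriction: $M\restriction X=(X,\mathcal{I}\cap\mathcal{P}(X))$; deletion $M\setminus X=M\restriction(E\setminus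 X)$; contraction $M/X$ is the matroid on $E\setminus X$ in which $J$ is independent iff $J\cup I$ is independent in $M$ for a maximal independent subset $I$ of $X$. Declaring the elements of $X$ to be loops gives $(M\setminus X)\oplus(X,\{\emptyset\})$. A covering of a family $(N_i\colon i\in K)$ of matroids on a common ground set $Y$ is a family $(R_i)$ with $R_i$ independent in $N_i$ and $\bigcup_iR_i=Y$; the family is tight if it admits a covering and in every covering each $R_i$ is spanning in $N_i$; $X\subseteq Y$ is tight for the family if $(N_i\restriction X\colon i\in K)$ is tight. A packing of $\mathcal{M}$ is a family of pairwise disjoint sets $(P_i)$ with $P_i$ spanning in $M_i$. Consider families $\mathcal{F}=(\langle I_i,S_i\rangle\colon i\in K)$ with $I_i\subseteq S_i\subseteq E$, $I_i$ independent and $S_i$ spanning in $M_i$, the $I_i$ pairwise disjoint, and $\bigcup_iS_i=E$. Such $\mathcal{F}$ is covering-feasible (resp. packing-feasible) if there is a covering (resp. packing) $(R_i)$ of $\mathcal{M}$ with $I_i\subseteq R_i\subseteq S_i$ for all $i$, and feasible if both. A family $\mathcal{F}'=(\langle I_i',S_i'\rangle)$ of this kind is an extension of $\mathcal{F}$ if $I_i\subseteq I_i'\subseteq S_i'\subseteq S_i$ for all $i$. $\mathcal{M}(\mathcal{F})=(M_i(\mathcal{F})\colon i\in K)$, where $M_i(\mathcal{F})$ is the matroid on $E\setminus\bigcup_{j}I_j$ obtained from $M_i$ by contracting $I_i$, deleting $\bigcup_{j\neq i}I_j$, and declaring the remaining elements not in $S_i$ to be loops. $\mathcal{M}(\mathcal{F})$-tight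 means tight for the family $\mathcal{M}(\mathcal{F})$. -}

module Defs where

import Level
open import Level using (0ℓ)
open import Data.Product using (Σ; ∃; ∃-syntax; _×_; _,_)
open import Data.Sum using (_⊎_)
open import Relation.Nullary using (¬_)
import Data.Empty
open import Relation.Binary.PropositionalEquality using (_≡_; _≢_)
open import Relation.Unary using (Pred; _∈_; _∉_; _⊆_; _∪_; _∩_; ∁; U; ｛_｝; Satisfiable)

Subset : Set → Set₁
Subset E = Pred E 0ℓ

module _ {E : Set} where

  Maximal : ∀ {ℓ} → Pred (Subset E) ℓ → Subset E → Set (Level.suc 0ℓ Level.⊔ ℓ)
  Maximal P B = P B × (∀ J → P J → B ⊆ J → J ⊆ B)

  -- Possibly infinite matroid on the ground set E (the whole type E),
  -- given by its independent sets, with axioms (I1),(I2),(I3),(IM).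
  record Matroid : Set₂ where
    field
      Ind   : Pred (Subset E) (Level.suc 0ℓ)
      I1    : Ind (λ _ → Data.Empty.⊥)
      I2    : ∀ I J → Ind J → I ⊆ J → Ind I
      I3    : ∀ I B → Ind I → ¬ Maximal Ind I → Maximal Ind B →
              ∃[ x ] (x ∈ B × x ∉ I × Ind (I ∪ ｛ x ｝))
      IM    : ∀ (X I : Subset E) → Ind I → I ⊆ X →
              ∃[ B ] (I ⊆ B × Maximal (λ J → Ind J × J ⊆ X) B)

  -- Used for matroids obtained from the M_i by minors/restrictions, whose
  -- independent sets are given by the explicit formulas of the paper.
  record SetSys : Set₂ where
    field
      ground : Subset E
      ind    : Pred (Subset E) (Level.suc 0ℓ)
  open SetSys public

  toSys : Matroid → SetSys
  toSys M = record { ground = U ; ind = Matroid.Ind M }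

  Circuit : SetSys → Subset E → Set₁
  Circuit N C = C ⊆ ground N × ¬ ind N C ×
                (∀ D → D ⊆ C → ¬ ind N D → C ⊆ D)

  SpansElt : SetSys → Subset E → E → Set₁
  SpansElt N X e = e ∈ X ⊎
    (∃[ C ] (Circuit N C × e ∈ C × (∀ y → y ∈ C → y ≢ e → y ∈ X)))

  Spans : SetSys → Subset E → Subset E → Set₁
  Spans N A Y = ∀ e → e ∈ Y → SpansElt N A e

  Spanning : SetSys → Subset E → Set₁
  Spanning N A = Spans N A (ground N)

  Restrict : SetSys → Subset E → SetSys
  Restrict N X = record { ground = ground N ∩ X
                        ; ind = λ J → ind N J × J ⊆ X }

  Delete : SetSys → Subset E → SetSys
  Delete N X = Restrict N (∁ X)

  Contract : SetSys → Subset E → SetSys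
  Contract N X = record
    { ground = ground N ∩ ∁ X
    ; ind = λ J → J ⊆ (ground N ∩ ∁ X) ×
                  ∃[ I ] (Maximal (λ I' → ind N I' × I' ⊆ X) I × ind N (J ∪ I)) }

  Loops : SetSys → Subset E → SetSys
  Loops N X = record { ground = ground N
                     ; ind = λ J → ind N J × J ⊆ ∁ X }

  module _ {K : Set} where

    ⋃ : (K → Subset E) → Subset E
    ⋃ R e = ∃[ i ] (e ∈ R i)

    Covering : Subset E → (K → SetSys) → (K → Subset E) → Set₁
    Covering Y N R = (∀ i → ind (N i) (R i)) × (∀ i → R i ⊆ Y) × (Y ⊆ ⋃ R)

    Tight : Subset E → (K → SetSys) → Set₁
    Tight Y N = (∃[ R ] Covering Y N R) ×
                (∀ R → Covering Y N R → ∀ i → Spans (N i) (R i) Y)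

    TightSet : Subset E → (K → SetSys) → Subset E → Set₁
    TightSet Y N X = X ⊆ Y × Tight X (λ i → Restrict (N i) X)

    LargestTightSet : Subset E → (K → SetSys) → Subset E → Set₁
    LargestTightSet Y N X = TightSet Y N X × (∀ Z → TightSet Y N Z → Z ⊆ X)

    record Fam : Set₁ where
      constructor ⟨_,_⟩
      field
        I : K → Subset E
        S : K → Subset E
    open Fam public

    module _ (M : K → Matroid) where

      Mˢ : K → SetSys
      Mˢ i = toSys (M i)

      Valid : Fam → Set₁
      Valid F = (∀ i → I F i ⊆ S F i) ×
                (∀ i → Matroid.Ind (M i) (I F i)) ×
                (∀ i → Spanning (Mˢ i) (S F i)) ×
                (∀ i j → i ≢ j → ∀ e → e ∈ I F i → e ∉ I F j) ×
                (∀ e → e ∈ ⋃ (S F))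

      Packing : (K → Subset E) → Set₁
      Packing P = (∀ i j → i ≢ j → ∀ e → e ∈ P i → e ∉ P j) ×
                  (∀ i → Spanning (Mˢ i) (P i))

      Between : Fam → (K → Subset E) → Set
      Between F R = ∀ i → I F i ⊆ R i × R i ⊆ S F i

      CoveringFeasible : Fam → Set₁
      CoveringFeasible F = ∃[ R ] (Covering U Mˢ R × Between F R)

      PackingFeasible : Fam → Set₁
      PackingFeasible F = ∃[ R ] (Packing R × Between F R)

      Feasible : Fam → Set₁
      Feasible F = CoveringFeasible F × PackingFeasible F

      Extension : Fam → Fam → Set₁
      Extension F F' = Valid F' ×
        (∀ i → I F i ⊆ I F' i × I F' i ⊆ S F' i × S F' i ⊆ S F i)

      GroundF : Fam → Subset E
      GroundF F = ∁ (⋃ (I F))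

      MF : Fam → K → SetSys
      MF F i = Loops (Delete (Contract (Mˢ i) (I F i))
                             (λ e → ∃[ j ] (j ≢ i × e ∈ I F j)))
                     (∁ (S F i))

module Submission where

-- Tightness of X means every covering
-- of M(F) ↾ X spans X ∩ S_i over I_i (covering-spans); hence the R_i are
-- disjoint and F' is a valid extension.  Old coverings and packings are
-- modified inside X, using exchange for coverings and span-trans for
-- packings.  If Z is tight for M(F'), then X ∪ Z is tight for M(F), which
-- gives the last claim.

open import Defs
open import Level using (0ℓ)
open import Data.Product using (∃; ∃-syntax; _×_; _,_; proj₁; proj₂)
open import Data.Sum using (_⊎_; inj₁; inj₂; [_,_]′)
open import Data.Empty using (⊥; ⊥-elim)
open import Data.Unit using (tt)
open import Relation.Nullary using (¬_)
open import Relation.Nullary.Decidable using (decidable-stable; toSum)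
open import Relation.Binary.PropositionalEquality using (_≡_; _≢_; refl; sym)
open import Relation.Unary using (_∈_; _∉_; _⊆_; _∪_; _∩_; ∁; U; ｛_｝; Satisfiable)
open import Axiom.ExcludedMiddle using (ExcludedMiddle)

module Classical (lem : ExcludedMiddle 0ℓ) where

  stable : {P : Set} → ¬ ¬ P → P
  stable = decidable-stable lem

  cases : ∀ {ℓ} {Q : Set ℓ} (P : Set) → (P → Q) → (¬ P → Q) → Q
  cases P if-yes if-no = [ if-yes , if-no ]′ (toSum (lem {P}))

module MatroidFacts (lem : ExcludedMiddle 0ℓ) {E : Set} (M : Matroid {E}) where
  open Matroid M
  open Classical lem

  ∅ : Subset E
  ∅ _ = ⊥

  _+_ : Subset E → E → Subset E
  A + x = A ∪ ｛ x ｝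

  _-_ : Subset E → E → Subset E
  (A - x) y = y ∈ A × y ≢ x

  +-⊆ : {A J : Subset E} {x : E} → A ⊆ J → x ∈ J → A + x ⊆ J
  +-⊆ A⊆J xJ (inj₁ a) = A⊆J a
  +-⊆ A⊆J xJ (inj₂ refl) = xJ

  +-mono : {A J : Subset E} {x : E} → A ⊆ J → A + x ⊆ J + x
  +-mono {A} {J} {x} A⊆J = +-⊆ {A} {J + x} (λ a → inj₁ (A⊆J a)) (inj₂ refl)

  Base : Subset E → Set₁
  Base = Maximal Ind

  BaseOf : Subset E → Subset E → Set₁
  BaseOf Y = Maximal (λ J → Ind J × J ⊆ Y)

  extend : (Y A : Subset E) → Ind A → A ⊆ Y → ∃[ B ] (A ⊆ B × BaseOf Y B)
  extend = IM

  baseOf : (Y : Subset E) → ∃[ B ] BaseOf Y B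
  baseOf Y = let (B , _ , base) = extend Y ∅ I1 (λ ()) in B , base

  absorb : ∀ {Y B x} → BaseOf Y B → x ∈ Y → Ind (B + x) → x ∈ B
  absorb ((_ , B⊆Y) , maximal) xY indBx =
    maximal _ (indBx , +-⊆ B⊆Y xY) inj₁ (inj₂ refl)

  closed⇒baseOf : ∀ {Y A} → Ind A → A ⊆ Y →
                  (∀ y → y ∈ Y → y ∉ A → ¬ Ind (A + y)) → BaseOf Y A
  closed⇒baseOf indA A⊆Y closed =
    (indA , A⊆Y) , λ J (indJ , J⊆Y) A⊆J {y} yJ →
      stable λ y∉A → closed y (J⊆Y yJ) y∉A (I2 _ J indJ (+-⊆ A⊆J yJ))

  baseOf-U⇒base : ∀ {B} → BaseOf U B → Base B
  baseOf-U⇒base ((indB , _) , maximal) =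
    indB , λ J indJ B⊆J → maximal J (indJ , λ _ → tt) B⊆J

  -- Contrapositive of (I3): an independent set that cannot be augmented
  -- from some base is itself a base.
  unaugmentable⇒base : ∀ {A B} → Ind A → Base B →
                       (∀ x → x ∈ B → x ∉ A → ¬ Ind (A + x)) → Base A
  unaugmentable⇒base {A} {B} indA baseB closed =
    indA , λ J indJ A⊆J {y} yJ → stable λ y∉A →
      let (x , xB , x∉A , indAx) =
            I3 A B indA (λ baseA → y∉A (proj₂ baseA J indJ A⊆J yJ)) baseB
      in closed x xB x∉A indAx

  -- Independence lives in Set₁; it is reflected into Set by comparing a
  -- set with a chosen base of it.  This lets sets be defined by conditions
  -- on independence, and makes independence ¬¬-stable.
  Indep₀ : Subset E → Set
  Indep₀ A = A ⊆ proj₁ (baseOf A)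

  indep₀⇒ind : ∀ {A} → Indep₀ A → Ind A
  indep₀⇒ind {A} A⊆B = I2 A _ (proj₁ (proj₁ (proj₂ (baseOf A)))) A⊆B

  ind⇒indep₀ : ∀ {A} → Ind A → Indep₀ A
  ind⇒indep₀ {A} indA = proj₂ (proj₂ (baseOf A)) A (indA , λ a → a) (proj₂ (proj₁ (proj₂ (baseOf A))))

  ind-stable : ∀ {A} → ¬ ¬ Ind A → Ind A
  ind-stable ¬¬indA = indep₀⇒ind (stable λ ¬indep₀ → ¬¬indA λ indA → ¬indep₀ (ind⇒indep₀ indA))

  base-trace : ∀ {Y B B' x} → BaseOf Y B → B ⊆ B' → Ind B' → x ∈ B' → x ∈ Y → x ∈ B
  base-trace {B = B} {B'} {x} baseB B⊆B' indB' xB' xY = absorb baseB xY (I2 (B + x) B' indB' (+-⊆ B⊆B' xB'))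

  -- Let B ⊆ B' be bases of Y and of M.  Any base J₁ of M whose part
  -- outside Y lies in B' contains all of B' outside Y: the independent set
  -- B ∪ (J₁ \ Y) ⊆ B' cannot be augmented from J₁, so it is all of B'.
  outside-in-base : ∀ {Y B B' J₁} → BaseOf Y B → B ⊆ B' → Base B' → Base J₁ →
                    J₁ ∩ ∁ Y ⊆ B' → B' ∩ ∁ Y ⊆ J₁
  outside-in-base {Y} {B} {B'} {J₁} baseB@((_ , B⊆Y) , _) B⊆B' (indB' , _) baseJ₁ J₁∖Y⊆B' (xB' , x∉Y) =
    [ (λ xB → ⊥-elim (x∉Y (B⊆Y xB))) , proj₁ ]′ (proj₂ baseJ₀ B' indB' J₀⊆B' xB')
    where
      J₀ : Subset E
      J₀ = B ∪ (J₁ ∩ ∁ Y)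
      J₀⊆B' : J₀ ⊆ B'
      J₀⊆B' = [ B⊆B' , J₁∖Y⊆B' ]′
      baseJ₀ : Base J₀
      baseJ₀ = unaugmentable⇒base (I2 J₀ B' indB' J₀⊆B') baseJ₁ λ y yJ₁ y∉J₀ indJ₀y → cases (y ∈ Y)
        (λ yY → y∉J₀ (inj₁ (absorb baseB yY (I2 (B + y) (J₀ + y) indJ₀y (+-mono {B} {J₀} {y} inj₁)))))
        (λ y∉Y → y∉J₀ (inj₂ (yJ₁ , y∉Y)))

  -- The core of the augmentation property of restrictions M ↾ Y: if no
  -- element of a base B of Y augments an independent J ⊆ Y, then no element
  -- z of Y does.  Otherwise extend B to a base B' of M and J + z to a base
  -- J₁ of M inside (J + z) ∪ (B' \ Y); then J ∪ (B' \ Y) ⊊ J₁ is a base of M.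
  unaugmentable-in : ∀ {Y J B} → Ind J → J ⊆ Y → BaseOf Y B →
                     (∀ x → x ∈ B → x ∉ J → ¬ Ind (J + x)) →
                     ∀ z → z ∈ Y → z ∉ J → ¬ Ind (J + z)
  unaugmentable-in {Y} {J} {B} indJ J⊆Y baseB@((indB , B⊆Y) , _) closed z zY z∉J indJz =
    z∉J₂ (proj₂ baseJ₂ J₁ indJ₁ J₂⊆J₁ (Jz⊆J₁ (inj₂ refl)))
    where
      extB : ∃[ B' ] (B ⊆ B' × BaseOf U B')
      extB = extend U B indB (λ _ → tt)
      B' : Subset E
      B' = proj₁ extB
      B⊆B' : B ⊆ B'
      B⊆B' = proj₁ (proj₂ extB)
      baseB' : Base B'
      baseB' = baseOf-U⇒base (proj₂ (proj₂ extB))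

      blocked : ∀ {A x} → J ⊆ A → x ∈ B' → x ∈ Y → x ∉ J → ¬ Ind (A + x)
      blocked {A} {x} J⊆A xB' xY x∉J indAx =
        closed x (base-trace baseB B⊆B' (proj₁ baseB') xB' xY) x∉J (I2 (J + x) (A + x) indAx (+-mono {J} {A} {x} J⊆A))

      extJz : ∃[ J₁ ] (J + z ⊆ J₁ × BaseOf ((J + z) ∪ (B' ∩ ∁ Y)) J₁)
      extJz = extend ((J + z) ∪ (B' ∩ ∁ Y)) (J + z) indJz inj₁
      J₁ : Subset E
      J₁ = proj₁ extJz
      Jz⊆J₁ : J + z ⊆ J₁
      Jz⊆J₁ = proj₁ (proj₂ extJz)
      baseOfJ₁ : BaseOf ((J + z) ∪ (B' ∩ ∁ Y)) J₁
      baseOfJ₁ = proj₂ (proj₂ extJz)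
      indJ₁ : Ind J₁
      indJ₁ = proj₁ (proj₁ baseOfJ₁)

      baseJ₁ : Base J₁
      baseJ₁ = unaugmentable⇒base indJ₁ baseB' λ x xB' x∉J₁ indJ₁x → cases (x ∈ Y)
        (λ xY → blocked (λ j → Jz⊆J₁ (inj₁ j)) xB' xY (λ xJ → x∉J₁ (Jz⊆J₁ (inj₁ xJ))) indJ₁x)
        (λ x∉Y → x∉J₁ (absorb baseOfJ₁ (inj₂ (xB' , x∉Y)) indJ₁x))

      J₁∖Y⊆B' : J₁ ∩ ∁ Y ⊆ B'
      J₁∖Y⊆B' (xJ₁ , x∉Y) with proj₂ (proj₁ baseOfJ₁) xJ₁
      ... | inj₁ xJz = ⊥-elim (x∉Y (+-⊆ J⊆Y zY xJz))
      ... | inj₂ (xB' , _) = xB'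

      J₂ : Subset E
      J₂ = J ∪ (B' ∩ ∁ Y)

      J₂⊆J₁ : J₂ ⊆ J₁
      J₂⊆J₁ = [ (λ xJ → Jz⊆J₁ (inj₁ xJ)) , outside-in-base baseB B⊆B' baseB' baseJ₁ J₁∖Y⊆B' ]′

      baseJ₂ : Base J₂
      baseJ₂ = unaugmentable⇒base (I2 J₂ J₁ indJ₁ J₂⊆J₁) baseB' λ x xB' x∉J₂ indJ₂x → cases (x ∈ Y)
        (λ xY → blocked inj₁ xB' xY (λ xJ → x∉J₂ (inj₁ xJ)) indJ₂x)
        (λ x∉Y → x∉J₂ (inj₂ (xB' , x∉Y)))

      z∉J₂ : z ∉ J₂
      z∉J₂ (inj₁ zJ) = z∉J zJ
      z∉J₂ (inj₂ (_ , z∉Y)) = z∉Y zY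

  augment-in : ∀ {Y J B} → Ind J → J ⊆ Y → ¬ BaseOf Y J → BaseOf Y B →
               ∃[ x ] (x ∈ B × x ∉ J × Ind (J + x))
  augment-in {Y} {J} {B} indJ J⊆Y notBase baseB =
    cases (∃[ x ] (x ∈ B × x ∉ J × Indep₀ (J + x)))
      (λ (x , xB , x∉J , indJx) → x , xB , x∉J , indep₀⇒ind indJx)
      (λ none → ⊥-elim (notBase (closed⇒baseOf indJ J⊆Y
         (unaugmentable-in indJ J⊆Y baseB λ x xB x∉J indJx →
            none (x , xB , x∉J , ind⇒indep₀ indJx)))))

  swap-into-base : ∀ {Y A B y} → BaseOf Y B → Ind A → A ⊆ Y → y ∈ A → y ∉ B →
                   ∃[ x ] (x ∈ B × x ∉ A × Ind ((A - y) + x))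
  swap-into-base {Y} {A} {B} {y} baseB indA A⊆Y yA y∉B =
    trade (augment-in (I2 (A - y) A indA proj₁) (λ a → A⊆Y (proj₁ a)) A-y-not-base baseB)
    where
      A-y-not-base : ¬ BaseOf Y (A - y)
      A-y-not-base (_ , maximal) = proj₂ (maximal A (indA , A⊆Y) proj₁ yA) refl
      -- the added element differs from y ∉ B
      trade : ∃[ x ] (x ∈ B × x ∉ A - y × Ind ((A - y) + x)) → ∃[ x ] (x ∈ B × x ∉ A × Ind ((A - y) + x))
      trade (x , xB , x∉A-y , indx) = x , xB , (λ xA → x∉A-y (xA , λ { refl → y∉B xB })) , indx

  Span : Subset E → E → Set₁
  Span Y e = e ∈ Y ⊎ ∃[ I ] (I ⊆ Y × Ind I × ¬ Ind (I + e))

  span-mono : ∀ {Y Y' e} → Y ⊆ Y' → Span Y e → Span Y' e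
  span-mono Y⊆Y' (inj₁ eY) = inj₁ (Y⊆Y' eY)
  span-mono Y⊆Y' (inj₂ (I , I⊆Y , indI , depIe)) = inj₂ (I , (λ i → Y⊆Y' (I⊆Y i)) , indI , depIe)

  ind-unspanned : ∀ {A Y e} → Ind A → e ∈ A → Y ⊆ A → e ∉ Y → ¬ Span Y e
  ind-unspanned _ _ _ e∉Y (inj₁ eY) = e∉Y eY
  ind-unspanned {A} {Y} {e} indA eA Y⊆A _ (inj₂ (J , J⊆Y , _ , depJe)) =
    depJe (I2 (J + e) A indA (+-⊆ (λ j → Y⊆A (J⊆Y j)) eA))

  base-spans : ∀ {Y B e} → BaseOf Y B → Span Y e → e ∉ Y → ¬ Ind (B + e)
  base-spans _ (inj₁ eY) e∉Y _ = e∉Y eY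
  base-spans {Y} {B} {e} baseB@((indB , B⊆Y) , _) (inj₂ (I , I⊆Y , indI , depIe)) e∉Y indBe =
    let (x , xB' , x∉B , indBx) = augment-in indB (λ b → inj₁ (B⊆Y b)) B-not-base baseB'
    in x∉B (absorb baseB (B'⊆Y xB') indBx)
    where
      extI : ∃[ B' ] (I ⊆ B' × BaseOf Y B')
      extI = extend Y I indI I⊆Y
      B' : Subset E
      B' = proj₁ extI
      I⊆B' : I ⊆ B'
      I⊆B' = proj₁ (proj₂ extI)
      baseOfB' : BaseOf Y B'
      baseOfB' = proj₂ (proj₂ extI)
      B'⊆Y : B' ⊆ Y
      B'⊆Y = proj₂ (proj₁ baseOfB')

      baseB' : BaseOf (Y + e) B'
      baseB' = closed⇒baseOf (proj₁ (proj₁ baseOfB')) (λ b → inj₁ (B'⊆Y b)) λ where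
        y (inj₁ yY) y∉B' indB'y → y∉B' (absorb baseOfB' yY indB'y)
        y (inj₂ refl) _ indB'e → depIe (I2 (I + e) (B' + e) indB'e (+-mono {I} {B'} {e} I⊆B'))

      B-not-base : ¬ BaseOf (Y + e) B
      B-not-base baseOfB = e∉Y (B⊆Y (absorb baseOfB (inj₂ refl) indBe))

  -- Transitivity of spanning: if Y spans every element of Z and Y ∪ Z
  -- spans e, then Y spans e.  A base of Y is shown to be a base of Y ∪ Z.
  span-trans : ∀ {Y Z e} → (∀ z → z ∈ Z → Span Y z) → Span (Y ∪ Z) e → Span Y e
  span-trans {Y} {Z} {e} spanZ spanE =
    cases (e ∈ Y) inj₁ λ e∉Y → cases (e ∈ Z) (spanZ e) λ e∉Z →
      inj₂ (B , B⊆Y , indB , base-spans baseYZ spanE [ e∉Y , e∉Z ]′)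
    where
      B : Subset E
      B = proj₁ (baseOf Y)
      baseB : BaseOf Y B
      baseB = proj₂ (baseOf Y)
      indB : Ind B
      indB = proj₁ (proj₁ baseB)
      B⊆Y : B ⊆ Y
      B⊆Y = proj₂ (proj₁ baseB)

      baseYZ : BaseOf (Y ∪ Z) B
      baseYZ = closed⇒baseOf indB (λ b → inj₁ (B⊆Y b)) λ where
        y (inj₁ yY) y∉B indBy → y∉B (absorb baseB yY indBy)
        y (inj₂ yZ) y∉B indBy → cases (y ∈ Y)
          (λ yY → y∉B (absorb baseB yY indBy))
          (λ y∉Y → base-spans baseB (spanZ y yZ) y∉Y indBy)

  exchange : ∀ {I₀ A R X} → Ind (I₀ ∪ A) → Ind (I₀ ∪ R) →
             (∀ z → z ∈ R → Span (I₀ ∪ (A ∩ X)) z) → Ind ((I₀ ∪ R) ∪ (A ∩ ∁ X))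
  exchange {I₀} {A} {R} {X} indI₀A indI₀R spanR = I2 Y B indB Y⊆B
    where
      Y : Subset E
      Y = (I₀ ∪ R) ∪ (A ∩ ∁ X)
      extI₀R : ∃[ B ] (I₀ ∪ R ⊆ B × BaseOf Y B)
      extI₀R = extend Y (I₀ ∪ R) indI₀R inj₁
      B : Subset E
      B = proj₁ extI₀R
      baseB : BaseOf Y B
      baseB = proj₂ (proj₂ extI₀R)
      indB : Ind B
      indB = proj₁ (proj₁ baseB)

      -- An a ∈ A \ X missing from B would be spanned by (I₀ ∪ A) - a,
      -- contradicting the independence of I₀ ∪ A.
      A∖X⊆B : ∀ {a} → a ∈ A → a ∉ X → ¬ a ∉ B
      A∖X⊆B {a} aA a∉X a∉B =
        ind-unspanned indI₀A (inj₂ aA) proj₁ (λ (_ , a≢a) → a≢a refl)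
          (span-trans spanR' (inj₂ (B , B⊆Y'∪R , indB , B+a-dependent)))
        where
          Y' : Subset E
          Y' = (I₀ ∪ A) - a
          spanR' : ∀ z → z ∈ R → Span Y' z
          spanR' z zR = span-mono I₀∪A∩X⊆Y' (spanR z zR)
            where
              I₀∪A∩X⊆Y' : I₀ ∪ (A ∩ X) ⊆ Y'
              I₀∪A∩X⊆Y' (inj₁ xI₀) = inj₁ xI₀ , λ { refl → a∉B (proj₁ (proj₂ extI₀R) (inj₁ xI₀)) }
              I₀∪A∩X⊆Y' (inj₂ (xA , xX)) = inj₂ xA , λ { refl → a∉X xX }
          B⊆Y'∪R : B ⊆ Y' ∪ R
          B⊆Y'∪R {b} bB with proj₂ (proj₁ baseB) bB
          ... | inj₁ (inj₁ bI₀) = inj₁ (inj₁ bI₀ , λ { refl → a∉B bB })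
          ... | inj₁ (inj₂ bR) = inj₂ bR
          ... | inj₂ (bA , _) = inj₁ (inj₂ bA , λ { refl → a∉B bB })
          B+a-dependent : ¬ Ind (B + a)
          B+a-dependent indBa = a∉B (absorb baseB (inj₂ (aA , a∉X)) indBa)

      Y⊆B : Y ⊆ B
      Y⊆B (inj₁ xI₀R) = proj₁ (proj₂ extI₀R) xI₀R
      Y⊆B (inj₂ (aA , a∉X)) = stable (A∖X⊆B aA a∉X)

  FundCircuit : (I₀ I : Subset E) → E → Subset E
  FundCircuit I₀ I e y = e ≡ y ⊎ (y ∈ I × Indep₀ (((I - y) + e) ∪ I₀))

  fund-⊆ : ∀ {I₀ I e y} → y ∈ FundCircuit I₀ I e → y ≢ e → y ∈ I
  fund-⊆ (inj₁ refl) y≢e = ⊥-elim (y≢e refl)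
  fund-⊆ (inj₂ (yI , _)) _ = yI

  fund-dependent : ∀ {I₀ I e} → Ind (I ∪ I₀) → ¬ Ind ((I + e) ∪ I₀) →
                   ¬ Ind (FundCircuit I₀ I e ∪ I₀)
  fund-dependent {I₀} {I} {e} indII₀ depIeI₀ indCI₀ =
    depIeI₀ (I2 Y B indB λ yY → stable (missing yY))
    where
      Y : Subset E
      Y = (I + e) ∪ I₀
      C⊆Y : FundCircuit I₀ I e ∪ I₀ ⊆ Y
      C⊆Y (inj₁ (inj₁ refl)) = inj₁ (inj₂ refl)
      C⊆Y (inj₁ (inj₂ (yI , _))) = inj₁ (inj₁ yI)
      C⊆Y (inj₂ yI₀) = inj₂ yI₀
      extC : ∃[ B ] (FundCircuit I₀ I e ∪ I₀ ⊆ B × BaseOf Y B)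
      extC = extend Y _ indCI₀ C⊆Y
      B : Subset E
      B = proj₁ extC
      C⊆B : FundCircuit I₀ I e ∪ I₀ ⊆ B
      C⊆B = proj₁ (proj₂ extC)
      baseB : BaseOf Y B
      baseB = proj₂ (proj₂ extC)
      indB : Ind B
      indB = proj₁ (proj₁ baseB)

      -- Swapping some y ∈ I \ B into B can only bring in e, so
      -- ((I - y) + e) ∪ I₀ is independent and y belongs to the circuit ⊆ B.
      swapped : ∀ {y x} → y ∈ I → y ∉ B → x ∈ B → x ∉ I ∪ I₀ → Ind (((I ∪ I₀) - y) + x) → ⊥
      swapped {y} {x} yI y∉B xB x∉II₀ indx with proj₂ (proj₁ baseB) xB
      ... | inj₁ (inj₁ xI) = x∉II₀ (inj₁ xI)
      ... | inj₂ xI₀ = x∉II₀ (inj₂ xI₀)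
      ... | inj₁ (inj₂ refl) =
        y∉B (C⊆B (inj₁ (inj₂ (yI , ind⇒indep₀ (I2 (((I - y) + e) ∪ I₀) _ indx reorder)))))
        where
          reorder : ((I - y) + e) ∪ I₀ ⊆ ((I ∪ I₀) - y) + e
          reorder (inj₁ (inj₁ (wI , w≢y))) = inj₁ (inj₁ wI , w≢y)
          reorder (inj₁ (inj₂ refl)) = inj₂ refl
          reorder (inj₂ wI₀) = inj₁ (inj₂ wI₀ , λ { refl → y∉B (C⊆B (inj₂ wI₀)) })

      -- Hence Y ⊆ B, although Y is dependent.
      missing : ∀ {y} → y ∈ Y → y ∉ B → ⊥
      missing (inj₁ (inj₁ yI)) y∉B =
        let (x , xB , x∉II₀ , indx) = swap-into-base baseB indII₀ [ (λ w → inj₁ (inj₁ w)) , inj₂ ]′ (inj₁ yI) y∉B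
        in swapped yI y∉B xB x∉II₀ indx
      missing (inj₁ (inj₂ refl)) e∉B = e∉B (C⊆B (inj₁ (inj₁ refl)))
      missing (inj₂ yI₀) y∉B = y∉B (C⊆B (inj₂ yI₀))

  fund-minimal : ∀ {I₀ I e D x} → Ind (I ∪ I₀) → D ⊆ FundCircuit I₀ I e →
                 x ∈ FundCircuit I₀ I e → x ∉ D → Ind (D ∪ I₀)
  fund-minimal {I₀} {I} {e} {D} indII₀ D⊆C (inj₁ refl) e∉D = I2 (D ∪ I₀) (I ∪ I₀) indII₀ D⊆
    where
      D⊆ : D ∪ I₀ ⊆ I ∪ I₀
      D⊆ (inj₁ dD) = inj₁ (fund-⊆ (D⊆C dD) λ { refl → e∉D dD })
      D⊆ (inj₂ dI₀) = inj₂ dI₀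
  fund-minimal {I₀} {I} {e} {D} {x} indII₀ D⊆C (inj₂ (_ , indep)) x∉D =
    I2 (D ∪ I₀) (((I - x) + e) ∪ I₀) (indep₀⇒ind indep) D⊆
    where
      D⊆ : D ∪ I₀ ⊆ ((I - x) + e) ∪ I₀
      D⊆ (inj₂ dI₀) = inj₂ dI₀
      D⊆ (inj₁ dD) with D⊆C dD
      ... | inj₁ refl = inj₁ (inj₂ refl)
      ... | inj₂ (dI , _) = inj₁ (inj₁ (dI , λ { refl → x∉D dD }))

  -- N is the minor of M obtained by contracting the independent set I₀,
  -- restricting to a ground set G disjoint from I₀, and declaring the
  -- elements outside P to be loops.
  record LoopedMinor (N : SetSys {E}) (I₀ G P : Subset E) : Set₁ where
    field
      I₀-ind   : Ind I₀
      ground⊆G : ground N ⊆ G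
      G⊆ground : G ⊆ ground N
      G-avoids : G ⊆ ∁ I₀
      ind⇒     : ∀ J → ind N J → J ⊆ G × J ⊆ P × Ind (J ∪ I₀)
      ⇒ind     : ∀ J → J ⊆ G → J ⊆ P → Ind (J ∪ I₀) → ind N J

  module LoopedMinorFacts {N I₀ G P} (minor : LoopedMinor N I₀ G P) where
    open LoopedMinor minor

    -- Spanning in N, expressed in M: e is a loop of N, or the part of A
    -- in N together with I₀ spans e in M.
    MinorSpan : Subset E → E → Set₁
    MinorSpan A e = e ∉ P ⊎ Span ((A ∩ G ∩ P) ∪ I₀) e

    indN-subset : ∀ {J J'} → ind N J → J' ⊆ J → ind N J'
    indN-subset {J} {J'} indJ J'⊆J with ind⇒ J indJ
    ... | J⊆G , J⊆P , indJI₀ =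
      ⇒ind J' (λ x → J⊆G (J'⊆J x)) (λ x → J⊆P (J'⊆J x))
           (I2 (J' ∪ I₀) (J ∪ I₀) indJI₀ [ (λ x → inj₁ (J'⊆J x)) , inj₂ ]′)

    indN-stable : ∀ {J} → ¬ ¬ ind N J → ind N J
    indN-stable {J} ¬¬indJ =
      ⇒ind J (stable λ k → ¬¬indJ λ indJ → k (proj₁ (ind⇒ J indJ)))
             (stable λ k → ¬¬indJ λ indJ → k (proj₁ (proj₂ (ind⇒ J indJ))))
             (ind-stable λ k → ¬¬indJ λ indJ → k (proj₂ (proj₂ (ind⇒ J indJ))))

    loop : ∀ {e} → e ∈ G → e ∉ P → Circuit N ｛ e ｝
    loop {e} eG e∉P = (λ { refl → G⊆ground eG }) , (λ indE → e∉P (proj₁ (proj₂ (ind⇒ _ indE)) refl)) , minimal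
      where
        minimal : ∀ D → D ⊆ ｛ e ｝ → ¬ ind N D → ｛ e ｝ ⊆ D
        minimal D D⊆e ¬indD refl = stable λ e∉D →
          ¬indD (⇒ind D (D-empty {G} e∉D) (D-empty {P} e∉D) (I2 (D ∪ I₀) I₀ I₀-ind [ D-empty {I₀} e∉D , (λ d → d) ]′))
          where
            D-empty : ∀ {Q : Subset E} → e ∉ D → D ⊆ Q
            D-empty e∉D dD with D⊆e dD
            ... | refl = ⊥-elim (e∉D dD)

    circuit : ∀ {I e} → I ⊆ G → I ⊆ P → Ind (I ∪ I₀) → e ∈ G → e ∈ P →
              ¬ Ind ((I + e) ∪ I₀) → Circuit N (FundCircuit I₀ I e)
    circuit {I} {e} I⊆G I⊆P indII₀ eG eP depIeI₀ =
      (λ x → G⊆ground (C⊆G x)) ,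
      (λ indC → fund-dependent indII₀ depIeI₀ (proj₂ (proj₂ (ind⇒ _ indC)))) ,
      λ D D⊆C ¬indD {x} xC → stable λ x∉D →
        ¬indD (⇒ind D (λ d → C⊆G (D⊆C d)) (λ d → C⊆P (D⊆C d)) (fund-minimal indII₀ D⊆C xC x∉D))
      where
        C⊆G : FundCircuit I₀ I e ⊆ G
        C⊆G (inj₁ refl) = eG
        C⊆G (inj₂ (xI , _)) = I⊆G xI
        C⊆P : FundCircuit I₀ I e ⊆ P
        C⊆P (inj₁ refl) = eP
        C⊆P (inj₂ (xI , _)) = I⊆P xI

    -- From spanning in M to spanning in N: via a loop, or via the
    -- fundamental circuit over a base of (A ∩ G ∩ P) ∪ I₀ extending I₀.
    minorSpan⇒spans : ∀ {A e} → e ∈ G → MinorSpan A e → SpansElt N A e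
    minorSpan⇒spans {A} {e} eG span = cases (e ∈ A) inj₁ λ e∉A → cases (e ∈ P)
      (λ eP → via-circuit eP e∉A span)
      (λ e∉P → inj₂ (｛ e ｝ , loop eG e∉P , refl , λ { _ refl e≢e → ⊥-elim (e≢e refl) }))
      where
        Y : Subset E
        Y = (A ∩ G ∩ P) ∪ I₀
        via-circuit : e ∈ P → e ∉ A → MinorSpan A e → SpansElt N A e
        via-circuit eP _ (inj₁ e∉P) = ⊥-elim (e∉P eP)
        via-circuit eP e∉A (inj₂ spanY) =
          inj₂ (FundCircuit I₀ J e ,
                circuit (λ x → proj₁ (proj₂ (proj₁ x))) (λ x → proj₂ (proj₂ (proj₁ x)))
                        (I2 (J ∪ I₀) B indB JI₀⊆B) eG eP depJeI₀ ,
                inj₁ refl , λ y yC y≢e → proj₁ (proj₁ (fund-⊆ yC y≢e)))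
          where
            extI₀ : ∃[ B ] (I₀ ⊆ B × BaseOf Y B)
            extI₀ = extend Y I₀ I₀-ind inj₂
            B : Subset E
            B = proj₁ extI₀
            baseB : BaseOf Y B
            baseB = proj₂ (proj₂ extI₀)
            indB : Ind B
            indB = proj₁ (proj₁ baseB)
            e∉Y : e ∉ Y
            e∉Y (inj₁ (eA , _)) = e∉A eA
            e∉Y (inj₂ eI₀) = G-avoids eG eI₀
            J : Subset E
            J = (A ∩ G ∩ P) ∩ B
            JI₀⊆B : J ∪ I₀ ⊆ B
            JI₀⊆B (inj₁ (_ , xB)) = xB
            JI₀⊆B (inj₂ xI₀) = proj₁ (proj₂ extI₀) xI₀
            depJeI₀ : ¬ Ind ((J + e) ∪ I₀)
            depJeI₀ indJe = base-spans baseB spanY e∉Y (I2 (B + e) _ indJe B+e⊆)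
              where
                B+e⊆ : B + e ⊆ (J + e) ∪ I₀
                B+e⊆ (inj₂ refl) = inj₁ (inj₂ refl)
                B+e⊆ (inj₁ xB) with proj₂ (proj₁ baseB) xB
                ... | inj₁ x∈AGP = inj₁ (inj₁ (x∈AGP , xB))
                ... | inj₂ xI₀ = inj₂ xI₀

    -- From spanning in N to spanning in M: a circuit C ∋ e of N with
    -- C - e ⊆ A yields the independent set (C - e) ∪ I₀.
    spans⇒minorSpan : ∀ {A e} → e ∈ G → SpansElt N A e → MinorSpan A e
    spans⇒minorSpan {A} {e} eG spans = cases (e ∈ P) (λ eP → inj₂ (via eP spans)) inj₁
      where
        via : e ∈ P → SpansElt N A e → Span ((A ∩ G ∩ P) ∪ I₀) e
        via eP (inj₁ eA) = inj₁ (inj₁ (eA , eG , eP))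
        via eP (inj₂ (C , (C⊆ground , ¬indC , minimal) , eC , C-e⊆A)) =
          inj₂ (D ∪ I₀ , D∪I₀⊆ , indDI₀ , dep)
          where
            D : Subset E
            D = C - e
            indD : ind N D
            indD = indN-stable λ ¬indD → proj₂ (minimal D proj₁ ¬indD eC) refl
            D⊆G : D ⊆ G
            D⊆G = proj₁ (ind⇒ D indD)
            D⊆P : D ⊆ P
            D⊆P = proj₁ (proj₂ (ind⇒ D indD))
            indDI₀ : Ind (D ∪ I₀)
            indDI₀ = proj₂ (proj₂ (ind⇒ D indD))
            D∪I₀⊆ : D ∪ I₀ ⊆ (A ∩ G ∩ P) ∪ I₀
            D∪I₀⊆ (inj₁ x∈D@(xC , x≢e)) = inj₁ (C-e⊆A _ xC x≢e , D⊆G x∈D , D⊆P x∈D)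
            D∪I₀⊆ (inj₂ xI₀) = inj₂ xI₀
            C⊆P : C ⊆ P
            C⊆P {x} xC = cases (x ≡ e) (λ { refl → eP }) (λ x≢e → D⊆P (xC , x≢e))
            C∪I₀⊆ : C ∪ I₀ ⊆ (D ∪ I₀) + e
            C∪I₀⊆ (inj₂ xI₀) = inj₁ (inj₂ xI₀)
            C∪I₀⊆ {x} (inj₁ xC) = cases (x ≡ e) (λ { refl → inj₂ refl }) (λ x≢e → inj₁ (inj₁ (xC , x≢e)))
            dep : ¬ Ind ((D ∪ I₀) + e)
            dep indDe = ¬indC (⇒ind C (λ x → ground⊆G (C⊆ground x)) C⊆P (I2 (C ∪ I₀) _ indDe C∪I₀⊆))

  -- M itself is a looped minor of M (nothing contracted, nothing a loop),
  -- so spanning in the set system of M is spanning in the sense of Span.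
  self-minor : LoopedMinor (toSys M) ∅ U U
  self-minor = record
    { I₀-ind = I1
    ; ground⊆G = λ x → x
    ; G⊆ground = λ x → x
    ; G-avoids = λ _ ()
    ; ind⇒ = λ J indJ → (λ _ → tt) , (λ _ → tt) , I2 (J ∪ ∅) J indJ [ (λ x → x) , (λ ()) ]′
    ; ⇒ind = λ J _ _ indJ∅ → I2 J (J ∪ ∅) indJ∅ inj₁
    }

  span⇒spans : ∀ {A e} → Span A e → SpansElt (toSys M) A e
  span⇒spans span = LoopedMinorFacts.minorSpan⇒spans self-minor tt
    (inj₂ (span-mono (λ a → inj₁ (a , tt , tt)) span))

  spans⇒span : ∀ {A e} → SpansElt (toSys M) A e → Span A e
  spans⇒span spans with LoopedMinorFacts.spans⇒minorSpan self-minor tt spans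
  ... | inj₁ e∉U = ⊥-elim (e∉U tt)
  ... | inj₂ span = span-mono [ proj₁ , (λ ()) ]′ span

module FamilyMinors (lem : ExcludedMiddle 0ℓ) {K E : Set} (M : K → Matroid {E}) where
  module Mᵢ (i : K) = MatroidFacts lem (M i)
  open MatroidFacts using (LoopedMinor)
  open Classical lem

  Minors : Fam {E} {K} → Subset E → K → SetSys {E}
  Minors F₀ Y i = Restrict (MF M F₀ i) Y

  restriction-minor : (F₀ : Fam {E} {K}) (i : K) → Matroid.Ind (M i) (I F₀ i) → (Y : Subset E) →
                      LoopedMinor lem (M i) (Minors F₀ Y i) (I F₀ i) (GroundF M F₀ ∩ Y) (S F₀ i)
  restriction-minor F₀ i indI Y = record
    { I₀-ind = indI
    ; ground⊆G = λ (((_ , x∉I) , x∉others) , xY) → outside x∉I x∉others , xY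
    ; G⊆ground = λ (x∉⋃I , xY) → ((tt , λ xI → x∉⋃I (i , xI)) , λ (j , _ , xIj) → x∉⋃I (j , xIj)) , xY
    ; G-avoids = λ (x∉⋃I , _) xI → x∉⋃I (i , xI)
    ; ind⇒ = λ J ((((J⊆ , (I* , maxI* , indJI*)) , J⊆others) , J⊆S) , J⊆Y) →
        (λ x → outside (proj₂ (J⊆ x)) (J⊆others x) , J⊆Y x) , (λ x → stable (J⊆S x)) ,
        Matroid.I2 (M i) (J ∪ I F₀ i) (J ∪ I*) indJI* [ inj₁ , (λ x → inj₂ (I⊆I* maxI* x)) ]′
    ; ⇒ind = λ J J⊆G J⊆S indJI →
        ((((λ x → tt , λ xI → proj₁ (J⊆G x) (i , xI)) ,
           (I F₀ i , ((indI , λ x → x) , λ _ indI' _ → proj₂ indI') , indJI)) ,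
          (λ x (j , _ , xIj) → proj₁ (J⊆G x) (j , xIj))) ,
         (λ x x∉S → x∉S (J⊆S x))) ,
        (λ x → proj₂ (J⊆G x))
    }
    where
      outside : ∀ {x} → x ∉ I F₀ i → ¬ (∃[ j ] (j ≢ i × x ∈ I F₀ j)) → x ∉ ⋃ (I F₀)
      outside x∉I x∉others (j , xIj) =
        cases (j ≡ i) (λ { refl → x∉I xIj }) (λ j≢i → x∉others (j , j≢i , xIj))
      -- the only maximal independent subset of the independent set I_i is I_i
      I⊆I* : ∀ {I*} → Maximal (λ J → Matroid.Ind (M i) J × J ⊆ I F₀ i) I* → I F₀ i ⊆ I*
      I⊆I* ((_ , I*⊆I) , maximal) = maximal (I F₀ i) (indI , λ x → x) I*⊆I

  module _ (F₀ : Fam {E} {K}) (i : K) (indI : Matroid.Ind (M i) (I F₀ i)) (Y : Subset E) where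
    private
      minor : LoopedMinor lem (M i) (Minors F₀ Y i) (I F₀ i) (GroundF M F₀ ∩ Y) (S F₀ i)
      minor = restriction-minor F₀ i indI Y
      open MatroidFacts.LoopedMinor minor
      open MatroidFacts.LoopedMinorFacts lem (M i) minor

    minor-ind⇒ : ∀ {J} → ind (Minors F₀ Y i) J →
                 J ⊆ GroundF M F₀ ∩ Y × J ⊆ S F₀ i × Matroid.Ind (M i) (J ∪ I F₀ i)
    minor-ind⇒ = ind⇒ _

    ⇒minor-ind : ∀ {J} → J ⊆ GroundF M F₀ ∩ Y → J ⊆ S F₀ i →
                 Matroid.Ind (M i) (J ∪ I F₀ i) → ind (Minors F₀ Y i) J
    ⇒minor-ind = ⇒ind _

    minor-ind-subset : ∀ {J J'} → ind (Minors F₀ Y i) J → J' ⊆ J → ind (Minors F₀ Y i) J'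
    minor-ind-subset = indN-subset

    minor-spans⇒ : ∀ {A e} → e ∈ GroundF M F₀ ∩ Y → e ∈ S F₀ i →
                   SpansElt (Minors F₀ Y i) A e → Mᵢ.Span i (I F₀ i ∪ A) e
    minor-spans⇒ eG eS spans with spans⇒minorSpan eG spans
    ... | inj₁ e∉S = ⊥-elim (e∉S eS)
    ... | inj₂ span = Mᵢ.span-mono i [ (λ x → inj₂ (proj₁ x)) , inj₁ ]′ span

    ⇒minor-spans : ∀ {A e} → ind (Minors F₀ Y i) A → e ∈ GroundF M F₀ ∩ Y →
                   (e ∈ S F₀ i → Mᵢ.Span i (I F₀ i ∪ A) e) → SpansElt (Minors F₀ Y i) A e
    ⇒minor-spans {A} {e} indA eG span = minorSpan⇒spans eG
      (cases (e ∈ S F₀ i) (λ eS → inj₂ (Mᵢ.span-mono i [ inj₂ , (λ a → inj₁ (a , A⊆G a , A⊆S a)) ]′ (span eS))) inj₁)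
      where
        A⊆G : A ⊆ GroundF M F₀ ∩ Y
        A⊆G = proj₁ (ind⇒ A indA)
        A⊆S : A ⊆ S F₀ i
        A⊆S = proj₁ (proj₂ (ind⇒ A indA))

module Extend (lem : ExcludedMiddle 0ℓ) {K E : Set} (M : K → Matroid {E})
  (F : Fam {E} {K}) (valid : Valid M F) (X : Subset E)
  (X-tight : TightSet (GroundF M F) (MF M F) X)
  (R : K → Subset E) (R-covers : Covering X (λ i → Restrict (MF M F i) X) R) where

  open FamilyMinors lem M
  open Mᵢ using (Span; span-mono; span-trans; exchange; ind-unspanned; span⇒spans; spans⇒span)
  open Classical lem

  Ind : K → Subset E → Set₁
  Ind i = Matroid.Ind (M i)

  I2 : ∀ i A B → Ind i B → A ⊆ B → Ind i A
  I2 i = Matroid.I2 (M i)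

  ∪-swap : ∀ {A B : Subset E} → A ∪ B ⊆ B ∪ A
  ∪-swap = [ inj₂ , inj₁ ]′

  I-ind : ∀ i → Ind i (I F i)
  I-ind = proj₁ (proj₂ valid)

  X⊆ground : X ⊆ GroundF M F
  X⊆ground = proj₁ X-tight

  covering-spans : ∀ A → Covering X (Minors F X) A →
                   ∀ i {x} → x ∈ X → x ∈ S F i → Span i (I F i ∪ A i) x
  covering-spans A covA i {x} xX xS =
    minor-spans⇒ F i (I-ind i) X (X⊆ground xX , xX) xS (proj₂ (proj₂ X-tight) A covA i x xX)

  R⊆X : ∀ i → R i ⊆ X
  R⊆X = proj₁ (proj₂ R-covers)

  X⊆⋃R : X ⊆ ⋃ R
  X⊆⋃R = proj₂ (proj₂ R-covers)

  R⊆ground : ∀ i → R i ⊆ GroundF M F ∩ X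
  R⊆ground i = proj₁ (minor-ind⇒ F i (I-ind i) X (proj₁ R-covers i))

  R⊆S : ∀ i → R i ⊆ S F i
  R⊆S i = proj₁ (proj₂ (minor-ind⇒ F i (I-ind i) X (proj₁ R-covers i)))

  R-avoids-I : ∀ i j {x} → x ∈ R i → x ∉ I F j
  R-avoids-I i j xR xI = proj₁ (R⊆ground i xR) (j , xI)

  I' : K → Subset E
  I' i = I F i ∪ R i

  F' : Fam {E} {K}
  F' = ⟨ I' , S F ⟩

  I'-ind : ∀ i → Ind i (I' i)
  I'-ind i = I2 i (I' i) (R i ∪ I F i) (proj₂ (proj₂ (minor-ind⇒ F i (I-ind i) X (proj₁ R-covers i))))
                (∪-swap {I F i} {R i})

  -- The parts of a covering of a tight set are disjoint: removing e from
  -- R_i leaves a covering, which would have to span e in M_i over I_i.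
  R-disjoint : ∀ i j → i ≢ j → ∀ e → e ∈ R i → e ∉ R j
  R-disjoint i j i≢j e eRi eRj =
    ind-unspanned i {I' i} {I F i ∪ R⁻ i} (I'-ind i) (inj₂ eRi) [ inj₁ , (λ x → inj₂ (proj₁ x)) ]′ e∉
      (covering-spans R⁻ R⁻-covers i (R⊆X i eRi) (R⊆S i eRi))
    where
      R⁻ : K → Subset E
      R⁻ k x = x ∈ R k × (k ≡ i → x ≢ e)
      R⁻-covers : Covering X (Minors F X) R⁻
      R⁻-covers = (λ k → minor-ind-subset F k (I-ind k) X (proj₁ R-covers k) proj₁) ,
                  (λ k x → R⊆X k (proj₁ x)) , cover
        where
          cover : X ⊆ ⋃ R⁻
          cover {x} xX with X⊆⋃R xX
          ... | k , xR = cases {Q = x ∈ ⋃ R⁻} (x ≡ e)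
            (λ { refl → j , eRj , λ j≡i → ⊥-elim (i≢j (sym j≡i)) })
            (λ x≢e → k , xR , λ _ → x≢e)
      e∉ : e ∉ I F i ∪ R⁻ i
      e∉ (inj₁ eI) = R-avoids-I i i eRi eI
      e∉ (inj₂ (_ , e≢e)) = e≢e refl refl


  I'⊆S : ∀ i → I' i ⊆ S F i
  I'⊆S i = [ proj₁ valid i , R⊆S i ]′

  I'-disjoint : ∀ i j → i ≢ j → ∀ e → e ∈ I' i → e ∉ I' j
  I'-disjoint i j i≢j e (inj₁ eI) (inj₁ eI') = proj₁ (proj₂ (proj₂ (proj₂ valid))) i j i≢j e eI eI'
  I'-disjoint i j i≢j e (inj₁ eI) (inj₂ eR) = R-avoids-I j i eR eI
  I'-disjoint i j i≢j e (inj₂ eR) (inj₁ eI) = R-avoids-I i j eR eI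
  I'-disjoint i j i≢j e (inj₂ eR) (inj₂ eR') = R-disjoint i j i≢j e eR eR'

  F'-extension : Extension M F F'
  F'-extension = (I'⊆S , I'-ind , proj₁ (proj₂ (proj₂ valid)) , I'-disjoint , proj₂ (proj₂ (proj₂ (proj₂ valid)))) ,
                 λ i → inj₁ , I'⊆S i , (λ x → x)

  I'-spans : ∀ i → Spans (Mˢ M i) (I' i) (X ∩ S F i)
  I'-spans i e (eX , eS) = span⇒spans i (covering-spans R R-covers i eX eS)

  -- Covering-feasibility of F' from that of F: keep I'_i and, outside X,
  -- the part of an old covering C inside the ground set of M(F).  By
  -- `exchange`, R_i can replace the part of C_i inside X.
  F'-covering-feasible : CoveringFeasible M F → CoveringFeasible M F'
  F'-covering-feasible (C , (C-ind , _ , C-covers) , C-between) =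
    C' , (C'-ind , (λ _ _ → tt) , C'-covers) , C'-between
    where
      D : K → Subset E
      D k = C k ∩ GroundF M F

      D∩X-covers : Covering X (Minors F X) (λ k → D k ∩ X)
      D∩X-covers =
        (λ k → ⇒minor-ind F k (I-ind k) X (λ ((_ , xG) , xX) → xG , xX)
                 (λ ((xC , _) , _) → proj₂ (C-between k) xC)
                 (I2 k ((D k ∩ X) ∪ I F k) (C k) (C-ind k) [ (λ x → proj₁ (proj₁ x)) , proj₁ (C-between k) ]′)) ,
        (λ k → proj₂) ,
        λ {x} xX → let (k , xC) = C-covers {x} tt in k , (xC , X⊆ground xX) , xX

      C' : K → Subset E
      C' i = I' i ∪ (D i ∩ ∁ X)

      C'-ind : ∀ i → Ind i (C' i)
      C'-ind i = exchange i (I2 i (I F i ∪ D i) (C i) (C-ind i) [ proj₁ (C-between i) , proj₁ ]′) (I'-ind i)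
                   λ z zR → covering-spans _ D∩X-covers i (R⊆X i zR) (R⊆S i zR)

      C'-covers : U ⊆ ⋃ C'
      C'-covers {x} _ = cases (x ∈ ⋃ (I F)) (λ (k , xI) → k , inj₁ (inj₁ xI)) λ x∉⋃I →
        cases (x ∈ X) (λ xX → let (k , xR) = X⊆⋃R xX in k , inj₁ (inj₂ xR)) λ x∉X →
        let (k , xC) = C-covers {x} tt in k , inj₂ ((xC , x∉⋃I) , x∉X)

      C'-between : Between M F' C'
      C'-between i = inj₁ , [ I'⊆S i , (λ ((xC , _) , _) → proj₂ (C-between i) xC) ]′

  -- Packing-feasibility of F' from that of F: replace the part inside X of
  -- an old packing by the I'_i.  Elements of P_i ∩ X are spanned by I'_i,
  -- so P'_i still spans what P_i spans.
  F'-packing-feasible : PackingFeasible M F → PackingFeasible M F'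
  F'-packing-feasible (P , (P-disjoint , P-spanning) , P-between) =
    P' , (P'-disjoint , P'-spanning) , P'-between
    where
      P' : K → Subset E
      P' i = I' i ∪ (P i ∩ ∁ X)

      P'-disjoint : ∀ i j → i ≢ j → ∀ e → e ∈ P' i → e ∉ P' j
      P'-disjoint i j i≢j e (inj₁ eI') (inj₁ eI'') = I'-disjoint i j i≢j e eI' eI''
      P'-disjoint i j i≢j e (inj₁ (inj₁ eI)) (inj₂ (eP , _)) = P-disjoint i j i≢j e (proj₁ (P-between i) eI) eP
      P'-disjoint i j i≢j e (inj₁ (inj₂ eR)) (inj₂ (_ , e∉X)) = e∉X (R⊆X i eR)
      P'-disjoint i j i≢j e (inj₂ (eP , _)) (inj₁ (inj₁ eI)) = P-disjoint i j i≢j e eP (proj₁ (P-between j) eI)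
      P'-disjoint i j i≢j e (inj₂ (_ , e∉X)) (inj₁ (inj₂ eR)) = e∉X (R⊆X j eR)
      P'-disjoint i j i≢j e (inj₂ (eP , _)) (inj₂ (eP' , _)) = P-disjoint i j i≢j e eP eP'

      P'-spanning : ∀ i → Spanning (Mˢ M i) (P' i)
      P'-spanning i e _ = span⇒spans i (span-trans i spans-P
        (span-mono i inj₂ (spans⇒span i (P-spanning i e tt))))
        where
          spans-P : ∀ z → z ∈ P i → Span i (P' i) z
          spans-P z zP = cases (z ∈ X)
            (λ zX → span-mono i inj₁ (covering-spans R R-covers i zX (proj₂ (P-between i) zP)))
            (λ z∉X → inj₁ (inj₂ (zP , z∉X)))

      P'-between : Between M F' P'
      P'-between i = inj₁ , [ I'⊆S i , (λ (xP , _) → proj₂ (P-between i) xP) ]′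

  module TightUnion (Z : Subset E) (Z-tight : TightSet (GroundF M F') (MF M F') Z) where

    Z⊆ground' : Z ⊆ GroundF M F'
    Z⊆ground' = proj₁ Z-tight

    -- Z avoids X, since X ⊆ ⋃ R ⊆ ⋃ I'.
    X∩Z-empty : ∀ {x} → x ∈ X → x ∉ Z
    X∩Z-empty xX xZ = let (k , xR) = X⊆⋃R xX in Z⊆ground' xZ (k , inj₂ xR)

    XZ⊆ground : X ∪ Z ⊆ GroundF M F
    XZ⊆ground = [ X⊆ground , (λ xZ (k , xI) → Z⊆ground' xZ (k , inj₁ xI)) ]′

    union-covering : ∀ T → Covering Z (Minors F' Z) T →
                     Covering (X ∪ Z) (Minors F (X ∪ Z)) (λ k → R k ∪ T k)
    union-covering T (T-ind , T⊆Z , Z⊆⋃T) =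
      RT-ind ,
      (λ k → [ (λ xR → inj₁ (R⊆X k xR)) , (λ xT → inj₂ (T⊆Z k xT)) ]′) ,
      [ (λ xX → let (k , xR) = X⊆⋃R xX in k , inj₁ xR) , (λ xZ → let (k , xT) = Z⊆⋃T xZ in k , inj₂ xT) ]′
      where
        RT-ind : ∀ k → ind (Minors F (X ∪ Z) k) (R k ∪ T k)
        RT-ind k = ⇒minor-ind F k (I-ind k) (X ∪ Z)
          [ (λ xR → proj₁ (R⊆ground k xR) , inj₁ (R⊆X k xR)) , (λ xT → XZ⊆ground (inj₂ (T⊆Z k xT)) , inj₂ (T⊆Z k xT)) ]′
          [ R⊆S k , proj₁ (proj₂ T-props) ]′
          (I2 k ((R k ∪ T k) ∪ I F k) (T k ∪ I' k) (proj₂ (proj₂ T-props)) reorder)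
          where
            T-props : T k ⊆ GroundF M F' ∩ Z × T k ⊆ S F k × Ind k (T k ∪ I' k)
            T-props = minor-ind⇒ F' k (I'-ind k) Z (T-ind k)
            reorder : (R k ∪ T k) ∪ I F k ⊆ T k ∪ I' k
            reorder (inj₁ (inj₁ xR)) = inj₂ (inj₂ xR)
            reorder (inj₁ (inj₂ xT)) = inj₁ xT
            reorder (inj₂ xI) = inj₂ (inj₁ xI)

    module _ (A : K → Subset E) (A-covers : Covering (X ∪ Z) (Minors F (X ∪ Z)) A) where
      private
        A-props : ∀ k → A k ⊆ GroundF M F ∩ (X ∪ Z) × A k ⊆ S F k × Ind k (A k ∪ I F k)
        A-props k = minor-ind⇒ F k (I-ind k) (X ∪ Z) (proj₁ A-covers k)

      trace-X : Covering X (Minors F X) (λ k → A k ∩ X)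
      trace-X =
        (λ k → ⇒minor-ind F k (I-ind k) X (λ (xA , xX) → proj₁ (proj₁ (A-props k) xA) , xX)
                 (λ (xA , _) → proj₁ (proj₂ (A-props k)) xA)
                 (I2 k ((A k ∩ X) ∪ I F k) (A k ∪ I F k) (proj₂ (proj₂ (A-props k))) [ (λ x → inj₁ (proj₁ x)) , inj₂ ]′)) ,
        (λ k → proj₂) ,
        λ xX → let (k , xA) = proj₂ (proj₂ A-covers) (inj₁ xX) in k , xA , xX

      -- The part of A outside X covers Z in M(F'): by `exchange`, R_k may
      -- replace A_k ∩ X, so it stays independent over I'_k.
      trace-Z : Covering Z (Minors F' Z) (λ k → A k ∩ ∁ X)
      trace-Z =
        (λ k → ⇒minor-ind F' k (I'-ind k) Z (λ (xA , x∉X) → Z⊆ground' (in-Z k xA x∉X) , in-Z k xA x∉X)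
                 (λ (xA , _) → proj₁ (proj₂ (A-props k)) xA)
                 (I2 k ((A k ∩ ∁ X) ∪ I' k) (I' k ∪ (A k ∩ ∁ X)) (exchanged k) (∪-swap {A k ∩ ∁ X} {I' k}))) ,
        (λ k (xA , x∉X) → in-Z k xA x∉X) ,
        λ xZ → let (k , xA) = proj₂ (proj₂ A-covers) (inj₂ xZ) in k , xA , λ xX → X∩Z-empty xX xZ
        where
          in-Z : ∀ k {x} → x ∈ A k → x ∉ X → x ∈ Z
          in-Z k xA x∉X = [ (λ xX → ⊥-elim (x∉X xX)) , (λ xZ → xZ) ]′ (proj₁ (proj₂ A-covers) k xA)
          exchanged : ∀ k → Ind k (I' k ∪ (A k ∩ ∁ X))
          exchanged k = exchange k (I2 k (I F k ∪ A k) (A k ∪ I F k) (proj₂ (proj₂ (A-props k))) (∪-swap {I F k} {A k}))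
                          (I'-ind k) λ z zR → covering-spans _ trace-X k (R⊆X k zR) (R⊆S k zR)

      -- A spans X ∪ Z: by tightness of X and Z, (I_i ∪ A_i) ∪ R_i spans X ∪ Z,
      -- and R_i is spanned by I_i ∪ A_i.
      union-spans : ∀ i → Spans (Minors F (X ∪ Z) i) (A i) (X ∪ Z)
      union-spans i e eXZ = ⇒minor-spans F i (I-ind i) (X ∪ Z) (proj₁ A-covers i) (XZ⊆ground eXZ , eXZ)
        λ eS → span-trans i R-spanned (spanned eXZ eS)
        where
          I∪A∩X⊆ : I F i ∪ (A i ∩ X) ⊆ I F i ∪ A i
          I∪A∩X⊆ = [ inj₁ , (λ x → inj₂ (proj₁ x)) ]′
          R-spanned : ∀ z → z ∈ R i → Span i (I F i ∪ A i) z
          R-spanned z zR = span-mono i I∪A∩X⊆ (covering-spans _ trace-X i (R⊆X i zR) (R⊆S i zR))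
          I'∪A∖X⊆ : I' i ∪ (A i ∩ ∁ X) ⊆ (I F i ∪ A i) ∪ R i
          I'∪A∖X⊆ (inj₁ (inj₁ xI)) = inj₁ (inj₁ xI)
          I'∪A∖X⊆ (inj₁ (inj₂ xR)) = inj₂ xR
          I'∪A∖X⊆ (inj₂ (xA , _)) = inj₁ (inj₂ xA)
          spanned : e ∈ X ∪ Z → e ∈ S F i → Span i ((I F i ∪ A i) ∪ R i) e
          spanned (inj₁ eX) eS = span-mono i (λ x → inj₁ (I∪A∩X⊆ x)) (covering-spans _ trace-X i eX eS)
          spanned (inj₂ eZ) eS = span-mono i I'∪A∖X⊆
            (minor-spans⇒ F' i (I'-ind i) Z (Z⊆ground' eZ , eZ) eS (proj₂ (proj₂ Z-tight) _ trace-Z i e eZ))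

    XZ-tight : TightSet (GroundF M F) (MF M F) (X ∪ Z)
    XZ-tight = XZ⊆ground ,
      (let (T , T-covers) = proj₁ (proj₂ Z-tight) in (λ k → R k ∪ T k) , union-covering T T-covers) ,
      union-spans

  -- If X is the largest tight set of M(F), then M(F') has no non-empty
  -- tight set Z: otherwise X ∪ Z would be a larger one.
  no-tight-set : LargestTightSet (GroundF M F) (MF M F) X →
                 ∀ Z → TightSet (GroundF M F') (MF M F') Z → ¬ Satisfiable Z
  no-tight-set (_ , largest) Z Z-tight (z , zZ) = X∩Z-empty (largest (X ∪ Z) XZ-tight (inj₂ zZ)) zZ
    where open TightUnion Z Z-tight

lemma3p11 : (lem : ExcludedMiddle 0ℓ) (K E : Set) (M : K → Matroid {E})
    (F : Fam {E} {K}) → Valid M F → Feasible M F →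
    (X : Subset E) → TightSet (GroundF M F) (MF M F) X →
    (R : K → Subset E) → Covering X (λ i → Restrict (MF M F i) X) R →
    (Extension M F ⟨ (λ i → I F i ∪ R i) , S F ⟩
      × Feasible M ⟨ (λ i → I F i ∪ R i) , S F ⟩)
    × (∀ i → Spans (Mˢ M i) (I F i ∪ R i) (X ∩ S F i))
    × (LargestTightSet (GroundF M F) (MF M F) X →
        ∀ Z → TightSet (GroundF M ⟨ (λ i → I F i ∪ R i) , S F ⟩)
                       (MF M ⟨ (λ i → I F i ∪ R i) , S F ⟩) Z →
              ¬ Satisfiable Z)
lemma3p11 lem K E M F valid (covering-feasible , packing-feasible) X X-tight R R-covers =
  (F'-extension , F'-covering-feasible covering-feasible , F'-packing-feasible packing-feasible) ,
  I'-spans ,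
  no-tight-set
  where open Extend lem M F valid X X-tight R R-covers
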